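{- Let $\mathcal{M}=(\Delta,M)$ be a saturated matching configuration, and let $\mathcal{Y}=(\Delta,T)$ be the coherent closure of $M$. Then $T=(M\cdot M)^\#$, where $M\cdot M=\{r\cdot s: r,s\in M\}$ and $(M\cdot M)^\#=(M\cdot M)\setminus\{\varnothing\}$.
   Context: For relations $r,s$ on $\Delta$: $r^*=\{(\beta,\alpha):(\alpha,\beta)\in r\}$, $\alpha r=\{\beta:(\alpha,\beta)\in r\}$, $r\cdot s=\{(\alpha,\gamma):\exists\beta,\ (\alpha,\beta)\in r,(\beta,\gamma)\in s\}$, $1_\Lambda=\{(\alpha,\alpha):\alpha\in\Lambda\}$. A partial coherent configuration is a pair $(\Delta,M)$ where $M$ is a partition of a subset of $\Delta\times\Delta$ such that $1_\Delta$ is a union of elements of $M$, $M^*=M$, and for all $r,s,t\in M$ the number $|\alpha r\cap\beta s^*|$ does not depend on $(\alpha,\beta)\in t$; its fibers are the sets $\Lambda$ with $1_\Lambda\in M$ (they partition $\Delta$). If $M$ partitions all of $\Delta\times\Delta$ it is a coherent configuration. A matching is a relation $\{(\alpha,f(\alpha)):\alpha\in\Lambda\}$ for a bijection $f:\Lambda\to\Lambda'$. Let the fibers of $\mathcal{M}$ be $\Delta_x$, indexed by $x\in X$; let $M(x,y)$ be the set of elements of $M$ contained in $\Delta_x\times\Delta_y$, $1_x=1_{\Delta_x}$, and write $x\sim y$ if $M(x,y)$ is a partition of $\Delta_x\times\Delta_y$ into matchings. $\mathcal{M}$ is a matching configuration if for all $x,y\in X$ with $M(x,y)\neq\varnothing$,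 either $x\sim y$, or $x=y$ and $M(x,x)=\{1_x\}$. It is saturated if for every $Y\subseteq X$ with $|Y|\le4$ there is $z\in X$ with $z\sim y$ for all $y\in Y$. The coherent closure of $M$ is the smallest coherent configuration $(\Delta,T)$ (with respect to: $(\Delta,T)\le(\Delta,T')$ iff every element of $T$ is a union of elements of $T'$) such that every element of $M$ is a union of elements of $T$. -}

module Defs where

open import Data.Nat using (ℕ; zero; suc; _+_; _≤_)
open import Data.Fin using (Fin; zero; suc)
open import Data.Bool using (Bool; true; false; _∧_; _∨_; if_then_else_)
open import Data.List using (List; length)
open import Data.List.Relation.Unary.Any using (Any)
open import Data.List.Relation.Unary.All using (All)
open import Data.List.Membership.Propositional using (_∈_)
open import Data.Product using (Σ; ∃; _×_; _,_)
open import Data.Sum using (_⊎_)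
open import Relation.Binary.PropositionalEquality using (_≡_; _≢_)
open import Relation.Nullary using (¬_)
import Data.Empty
import Data.Fin
import Data.List

-- The ground set Δ is Fin n. A subset of Δ is a Bool-valued predicate,
-- a binary relation on Δ is a Bool-valued function of two arguments.
Subset : ℕ → Set
Subset n = Fin n → Bool

Rel : ℕ → Set
Rel n = Fin n → Fin n → Bool

module _ {n : ℕ} where

  card : ∀ {m} → (Fin m → Bool) → ℕ
  card {zero}  f = 0
  card {suc m} f = (if f zero then 1 else 0) + card (λ i → f (suc i))

  anyF : ∀ {m} → (Fin m → Bool) → Bool
  anyF {zero}  f = false
  anyF {suc m} f = f zero ∨ anyF (λ i → f (suc i))

  conv : Rel n → Rel n
  conv r a b = r b a

  comp : Rel n → Rel n → Rel n
  comp r s a c = anyF (λ b → r a b ∧ s b c)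

  diag : Subset n → Rel n
  diag Λ a b with Λ a | Data.Fin._≟_ a b
  ... | true  | Relation.Nullary.yes _ = true
  ... | _     | _ = false

  prod : Subset n → Subset n → Rel n
  prod Λ Λ' a b = Λ a ∧ Λ' b

  full : Rel n
  full a b = true

  _≐_ : Rel n → Rel n → Set
  r ≐ s = ∀ a b → r a b ≡ s a b

  _≐ₛ_ : Subset n → Subset n → Set
  Λ ≐ₛ Λ' = ∀ a → Λ a ≡ Λ' a

  _⊆_ : Rel n → Rel n → Set
  r ⊆ s = ∀ a b → r a b ≡ true → s a b ≡ true

  Disjoint : Rel n → Rel n → Set
  Disjoint r s = ∀ a b → r a b ≡ true → s a b ≡ true → Data.Empty.⊥

  NonEmpty : Rel n → Set
  NonEmpty r = Σ (Fin n) λ a → Σ (Fin n) λ b → r a b ≡ true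

  _∈ₑ_ : Rel n → List (Rel n) → Set
  r ∈ₑ M = Any (λ s → r ≐ s) M

  IsUnionOf : Rel n → List (Rel n) → Set
  IsUnionOf s M =
    (∀ a b → s a b ≡ true → Any (λ r → r a b ≡ true) M) ×
    All (λ r → r ⊆ s ⊎ Disjoint r s) M

  IsPartialPartition : List (Rel n) → Set
  IsPartialPartition M =
    All NonEmpty M ×
    (∀ i j → i ≢ j →
       Disjoint (Data.List.lookup M i) (Data.List.lookup M j))

  interNum : Rel n → Rel n → Fin n → Fin n → ℕ
  interNum r s α β = card (λ γ → r α γ ∧ s γ β)

  IsPartialCoherentConfiguration : List (Rel n) → Set
  IsPartialCoherentConfiguration M =
    IsPartialPartition M ×
    IsUnionOf (diag (λ _ → true)) M ×
    All (λ r → conv r ∈ₑ M) M ×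
    (∀ {r s t} → r ∈ M → s ∈ M → t ∈ M →
       ∀ α β α' β' → t α β ≡ true → t α' β' ≡ true →
       interNum r s α β ≡ interNum r s α' β')

  IsCoherentConfiguration : List (Rel n) → Set
  IsCoherentConfiguration M =
    IsPartialCoherentConfiguration M ×
    (∀ a b → Any (λ r → r a b ≡ true) M)

  IsFiber : List (Rel n) → Subset n → Set
  IsFiber M Λ = diag Λ ∈ₑ M

  InBlock : Subset n → Subset n → Rel n → Set
  InBlock Λ Λ' r = r ⊆ prod Λ Λ'

  IsMatching : Subset n → Subset n → Rel n → Set
  IsMatching Λ Λ' r =
    r ⊆ prod Λ Λ' ×
    (∀ a → Λ a ≡ true →
       Σ (Fin n) λ b → r a b ≡ true × (∀ b' → r a b' ≡ true → b' ≡ b)) ×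
    (∀ b → Λ' b ≡ true →
       Σ (Fin n) λ a → r a b ≡ true × (∀ a' → r a' b ≡ true → a' ≡ a))

  -- Λ ∼ Λ' : M(Λ,Λ') is a partition of Λ × Λ' into matchings
  -- (disjointness is inherited from M)
  Sim : List (Rel n) → Subset n → Subset n → Set
  Sim M Λ Λ' =
    All (λ r → InBlock Λ Λ' r → IsMatching Λ Λ' r) M ×
    (∀ a b → prod Λ Λ' a b ≡ true →
       Any (λ r → InBlock Λ Λ' r × r a b ≡ true) M)

  IsMatchingConfiguration : List (Rel n) → Set
  IsMatchingConfiguration M =
    IsPartialCoherentConfiguration M ×
    (∀ Λ Λ' → IsFiber M Λ → IsFiber M Λ' →
       Any (InBlock Λ Λ') M →
       Sim M Λ Λ' ⊎
       (Λ ≐ₛ Λ' × All (λ r → InBlock Λ Λ r → r ≐ diag Λ) M))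

  IsSaturated : List (Rel n) → Set
  IsSaturated M =
    ∀ (Y : List (Subset n)) → All (IsFiber M) Y → length Y ≤ 4 →
      Σ (Subset n) λ z → IsFiber M z × All (Sim M z) Y

  _≤ᶜ_ : List (Rel n) → List (Rel n) → Set
  T ≤ᶜ T' = All (λ r → IsUnionOf r T') T

  IsCoherentClosure : List (Rel n) → List (Rel n) → Set
  IsCoherentClosure M T =
    IsCoherentConfiguration T ×
    M ≤ᶜ T ×
    (∀ T' → IsCoherentConfiguration T' → M ≤ᶜ T' → T ≤ᶜ T')

  EqualsNonemptyProducts : List (Rel n) → List (Rel n) → Set
  EqualsNonemptyProducts M T =
    (All (λ t → NonEmpty t ×
        Σ (Rel n) λ r → Σ (Rel n) λ s → r ∈ M × s ∈ M × t ≐ comp r s) T) ×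
    (∀ {r s} → r ∈ M → s ∈ M → NonEmpty (comp r s) → comp r s ∈ₑ T)

-- Two facts about a matching configuration drive everything: every
-- cell r ∈ M is a matching between two fibers, and (triangle lemma) if cells
-- r, s, d pass through (α,β), (β,γ), (α,γ) then d = r·s.  Saturation provides,
-- for any four points, a point c joined by cells to all of them; rerouting
-- paths through such points with the triangle lemma shows that two products
-- of cells that meet are equal, and that a nonempty product of two products is
-- again a product.  Hence the list `products` of the nonempty products r·s
-- (without repetitions) is a coherent configuration refining M, with
-- intersection numbers 0 or 1.  Minimality of the closure gives T ≤ products,
-- so every cell of T contains the product of cells through any of its pairs;
-- conversely, coherence of T shows that a cell of T lies inside every product
-- of cells of M that it meets.
module Submission where

open import Defs
open import Level using (0ℓ) renaming (suc to lsuc)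
open import Data.Nat using (ℕ; zero; suc; s≤s; z≤n)
open import Data.Fin using (Fin; zero; suc)
import Data.Fin.Properties as Fin
open import Data.Bool using (Bool; true; false; _∧_; if_then_else_)
open import Data.Bool.Properties using (∧-conicalˡ; ∧-conicalʳ; ¬-not)
  renaming (_≟_ to _≟ᵇ_)
open import Data.Product using (Σ; ∃; _×_; _,_; proj₁; proj₂)
open import Data.Sum using (_⊎_; inj₁; inj₂)
open import Data.Empty using (⊥-elim)
open import Function using (_∘_; flip; id)
open import Relation.Nullary using (Dec; yes; no)
open import Relation.Binary.Bundles using (Setoid; DecSetoid)
open import Relation.Binary.Core using (_⇒_; _⇔_)
import Relation.Binary.Reasoning.Setoid as SetoidReasoning
open import Relation.Binary.PropositionalEquality
  using (_≡_; _≢_; refl; sym; trans; cong; subst; module ≡-Reasoning)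
open import Data.List using (List; []; _∷_; lookup; filter; cartesianProductWith; deduplicate)
open import Data.List.Relation.Unary.Any using (Any)
import Data.List.Relation.Unary.Any as Any
import Data.List.Relation.Unary.Any.Properties as Anyₚ
open import Data.List.Relation.Unary.All using (All; []; _∷_)
import Data.List.Relation.Unary.All as All
open import Data.List.Relation.Unary.AllPairs using (AllPairs; []; _∷_)
open import Data.List.Relation.Unary.Unique.DecSetoid.Properties using (deduplicate-!)
open import Data.List.Membership.Propositional using (_∈_; find; lose)
open import Data.List.Membership.Propositional.Properties
  using (∈-lookup; ∈-filter⁺; ∈-filter⁻; ∈-cartesianProductWith⁺; ∈-cartesianProductWith⁻)

private
  variable
    n : ℕ

∧-true⁻ : ∀ {x y} → x ∧ y ≡ true → x ≡ true × y ≡ true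
∧-true⁻ {x} {y} e = ∧-conicalˡ x y e , ∧-conicalʳ x y e

∧-true⁺ : ∀ {x y} → x ≡ true → y ≡ true → x ∧ y ≡ true
∧-true⁺ refl refl = refl

true-ext : ∀ {x y} → (x ≡ true → y ≡ true) → (y ≡ true → x ≡ true) → x ≡ y
true-ext {true}  {true}  _ _ = refl
true-ext {true}  {false} f _ = sym (f refl)
true-ext {false} {true}  _ g = g refl
true-ext {false} {false} _ _ = refl

-- Search and counting over Fin m.  (The parameter n of anyF and card is
-- irrelevant to their value.)

module _ {n : ℕ} where

  anyF-sound : ∀ {m} (f : Fin m → Bool) → anyF {n} f ≡ true → ∃ λ i → f i ≡ true
  anyF-sound {suc m} f e with f zero in f0
  ... | true  = zero , f0
  ... | false = let i , fi = anyF-sound (f ∘ suc) e in suc i , fi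

  anyF-complete : ∀ {m} (f : Fin m → Bool) i → f i ≡ true → anyF {n} f ≡ true
  anyF-complete f zero e rewrite e = refl
  anyF-complete f (suc i) e with f zero
  ... | true  = refl
  ... | false = anyF-complete (f ∘ suc) i e

  card-zero : ∀ {m} (f : Fin m → Bool) → (∀ i → f i ≡ false) → card {n} f ≡ 0
  card-zero {zero}  f none = refl
  card-zero {suc m} f none rewrite none zero = card-zero (f ∘ suc) (none ∘ suc)

  card-nonzero : ∀ {m} (f : Fin m → Bool) i → f i ≡ true → card {n} f ≢ 0
  card-nonzero f zero e rewrite e = λ ()
  card-nonzero f (suc i) e with f zero
  ... | true  = λ ()
  ... | false = card-nonzero (f ∘ suc) i e

  card-witness : ∀ {m} (f g : Fin m → Bool) → card {n} f ≡ card {n} g →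
                 ∀ i → f i ≡ true → ∃ λ j → g j ≡ true
  card-witness f g same i fi with Fin.any? (λ j → g j ≟ᵇ true)
  ... | yes witness = witness
  ... | no none = ⊥-elim (card-nonzero f i fi
          (trans same (card-zero g (λ j → ¬-not (λ gj → none (j , gj))))))

  card-subsingleton : ∀ {m} (f : Fin m → Bool) →
    (∀ i j → f i ≡ true → f j ≡ true → i ≡ j) →
    card {n} f ≡ (if anyF {n} f then 1 else 0)
  card-subsingleton {zero}  f unique = refl
  card-subsingleton {suc m} f unique with f zero in f0
  ... | true  = cong suc (card-zero (f ∘ suc) λ i → ¬-not λ fi → 0≢suc (unique zero (suc i) f0 fi))
    where
    0≢suc : ∀ {k} {i : Fin k} → zero ≢ suc i
    0≢suc ()
  ... | false = card-subsingleton (f ∘ suc) λ i j fi fj → Fin.suc-injective (unique (suc i) (suc j) fi fj)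

PRel : ℕ → Set₁
PRel n = Fin n → Fin n → Set

infixr 9 _⨾_

-- relational composition; Relation.Binary.Construct.Composition calls it _;_,
-- a name that cannot be imported because ';' is reserved syntax
_⨾_ : PRel n → PRel n → PRel n
(P ⨾ Q) x z = ∃ λ y → P x y × Q y z

⟦_⟧ : Rel n → PRel n
⟦ r ⟧ x y = r x y ≡ true

⇔-setoid : ℕ → Setoid (lsuc 0ℓ) 0ℓ
⇔-setoid n = record
  { Carrier       = PRel n
  ; _≈_           = _⇔_
  ; isEquivalence = record
    { refl  = id , id
    ; sym   = λ (f , g) → g , f
    ; trans = λ (f , g) (f' , g') → f' ∘ f , g ∘ g'
    }
  }

module _ {n : ℕ} where

  open Setoid (⇔-setoid n) public
    using () renaming (refl to ⇔-refl; sym to ⇔-sym; trans to ⇔-trans)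

  ⨾-assoc : {P Q R : PRel n} → (P ⨾ Q) ⨾ R ⇔ P ⨾ (Q ⨾ R)
  ⨾-assoc = (λ (y , (x , p , q) , r) → x , p , y , q , r)
          , (λ (x , p , y , q , r) → y , (x , p , q) , r)

  ⨾-assoc₄ : {P Q R S : PRel n} → (P ⨾ Q) ⨾ (R ⨾ S) ⇔ (P ⨾ (Q ⨾ R)) ⨾ S
  ⨾-assoc₄ = (λ (y , (x , p , q) , (z , r , s)) → z , (x , p , y , q , r) , s)
           , (λ (z , (x , p , y , q , r) , s) → y , (x , p , q) , (z , r , s))

  ⨾-cong : {P P' Q Q' : PRel n} → P ⇔ P' → Q ⇔ Q' → P ⨾ Q ⇔ P' ⨾ Q'
  ⨾-cong (f , f') (g , g') = (λ (y , p , q) → y , f p , g q)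
                           , (λ (y , p , q) → y , f' p , g' q)

  comp⇔ : (r s : Rel n) → ⟦ comp r s ⟧ ⇔ ⟦ r ⟧ ⨾ ⟦ s ⟧
  comp⇔ r s = (λ {x} {z} e → let y , e' = anyF-sound {n} (λ y → r x y ∧ s y z) e
                              in y , ∧-true⁻ e')
            , (λ {x} {z} (y , rxy , syz) → anyF-complete {n} (λ y → r x y ∧ s y z) y (∧-true⁺ rxy syz))

  ⇔⇒≐ : {r s : Rel n} → ⟦ r ⟧ ⇔ ⟦ s ⟧ → r ≐ s
  ⇔⇒≐ (f , g) x y = true-ext f g

  interNum-indicator : (r s : Rel n) (α β : Fin n) →
    (∀ {γ γ'} → r α γ ≡ true → r α γ' ≡ true → γ ≡ γ') →
    interNum r s α β ≡ (if comp r s α β then 1 else 0)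
  interNum-indicator r s α β functional = card-subsingleton {n} (λ γ → r α γ ∧ s γ β)
    λ γ γ' e e' → functional (proj₁ (∧-true⁻ e)) (proj₁ (∧-true⁻ e'))

  identity : Rel n
  identity = diag (λ _ → true)

  diag-sound : (Λ : Subset n) {a b : Fin n} → diag Λ a b ≡ true → Λ a ≡ true × a ≡ b
  diag-sound Λ {a} {b} e with Λ a | a Fin.≟ b
  ... | true | yes a≡b = refl , a≡b

  diag-refl : (Λ : Subset n) (a : Fin n) → diag Λ a a ≡ Λ a
  diag-refl Λ a with Λ a | a Fin.≟ a
  ... | true  | yes _ = refl
  ... | true  | no a≢a = ⊥-elim (a≢a refl)
  ... | false | _ = refl

  diagonal-matching : {Λ Λ' : Subset n} {r : Rel n} → Λ ≐ₛ Λ' → r ≐ diag Λ → IsMatching Λ Λ' r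
  diagonal-matching {Λ} {Λ'} {r} Λ≐Λ' r≐1 = inside
    , (λ x Λx → x , loop Λx , λ y e → sym (proj₂ (on-diagonal e)))
    , (λ y Λ'y → y , loop (trans (Λ≐Λ' y) Λ'y) , λ x e → proj₂ (on-diagonal e))
    where
    on-diagonal : ∀ {x y} → r x y ≡ true → Λ x ≡ true × x ≡ y
    on-diagonal {x} {y} e = diag-sound Λ (trans (sym (r≐1 x y)) e)
    loop : ∀ {x} → Λ x ≡ true → r x x ≡ true
    loop {x} Λx = trans (r≐1 x x) (trans (diag-refl Λ x) Λx)
    inside : r ⊆ prod Λ Λ'
    inside x y e with on-diagonal e
    ... | Λx , refl = ∧-true⁺ Λx (trans (sym (Λ≐Λ' x)) Λx)

module _ {n : ℕ} {L : List (Rel n)} where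

  path-transfer : IsPartialCoherentConfiguration L → ∀ {r s t α β α' β'} →
    r ∈ L → s ∈ L → t ∈ L → t α β ≡ true → t α' β' ≡ true →
    (⟦ r ⟧ ⨾ ⟦ s ⟧) α β → (⟦ r ⟧ ⨾ ⟦ s ⟧) α' β'
  path-transfer (_ , _ , _ , coherent) {r} {s} {t} {α} {β} {α'} {β'} r∈ s∈ t∈ tαβ tα'β' (γ , rαγ , sγβ)
    with card-witness {n} (λ γ → r α γ ∧ s γ β) (λ γ → r α' γ ∧ s γ β')
           (coherent r∈ s∈ t∈ α β α' β' tαβ tα'β') γ (∧-true⁺ rαγ sγβ)
  ... | γ' , e = γ' , ∧-true⁻ e

  cell-⊆-union : ∀ {s r a b} → IsUnionOf s L → r ∈ L → r a b ≡ true → s a b ≡ true → r ⊆ s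
  cell-⊆-union (_ , dichotomy) r∈ rab sab with All.lookup dichotomy r∈
  ... | inj₁ r⊆s = r⊆s
  ... | inj₂ disjoint = ⊥-elim (disjoint _ _ rab sab)

  covering-cell : ∀ {s a b} → IsUnionOf s L → s a b ≡ true →
                  Σ (Rel n) λ u → u ∈ L × u a b ≡ true × u ⊆ s
  covering-cell {a = a} {b} union sab with find (proj₁ union a b sab)
  ... | u , u∈ , uab = u , u∈ , uab , cell-⊆-union union u∈ uab sab

  fiber-inhabited : IsPartialPartition L → ∀ {Λ} → IsFiber L Λ → ∃ λ a → Λ a ≡ true
  fiber-inhabited (nonempty , _) {Λ} fiber with find fiber
  ... | r , r∈ , 1Λ≐r with All.lookup nonempty r∈
  ... | a , b , rab = a , proj₁ (diag-sound Λ (trans (1Λ≐r a b) rab))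

contained-or-disjoint : {t u : Rel n} →
  (∀ {a b} → t a b ≡ true → u a b ≡ true → t ⊆ u) → t ⊆ u ⊎ Disjoint t u
contained-or-disjoint {t = t} {u} meet⇒⊆
  with Fin.any? (λ a → Fin.any? (λ b → (t a b ∧ u a b) ≟ᵇ true))
... | yes (a , b , e) = inj₁ (meet⇒⊆ (proj₁ (∧-true⁻ e)) (proj₂ (∧-true⁻ e)))
... | no apart = inj₂ λ a b tab uab → apart (a , b , ∧-true⁺ tab uab)

lookup-distinct : ∀ {a r} {A : Set a} {R : A → A → Set r} → (∀ {x y} → R x y → R y x) →
  ∀ {xs} → AllPairs R xs → ∀ i j → i ≢ j → R (lookup xs i) (lookup xs j)
lookup-distinct sym-R (_  ∷ _)   zero    zero    i≢j = ⊥-elim (i≢j refl)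
lookup-distinct sym-R (Rx ∷ _)   zero    (suc j) _   = All.lookup Rx (∈-lookup j)
lookup-distinct sym-R (Rx ∷ _)   (suc i) zero    _   = sym-R (All.lookup Rx (∈-lookup i))
lookup-distinct sym-R (_  ∷ Rxs) (suc i) (suc j) i≢j = lookup-distinct sym-R Rxs i j (i≢j ∘ cong suc)

-- Matching configurations.

module MatchingConfiguration {n : ℕ} {M : List (Rel n)}
                             (matching : IsMatchingConfiguration M) where

  coherent : IsPartialCoherentConfiguration M
  coherent = proj₁ matching

  partition : IsPartialPartition M
  partition = proj₁ coherent

  identity-union : IsUnionOf identity M
  identity-union = proj₁ (proj₂ coherent)

  converse-closed : All (λ r → conv r ∈ₑ M) M
  converse-closed = proj₁ (proj₂ (proj₂ coherent))

  CellAt : Fin n → Fin n → Set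
  CellAt x y = Σ (Rel n) λ r → r ∈ M × r x y ≡ true

  ⟪_⟫ : ∀ {x y} → CellAt x y → PRel n
  ⟪ ρ ⟫ = ⟦ proj₁ ρ ⟧

  loop : (a : Fin n) → CellAt a a
  loop a = find (proj₁ identity-union a a (diag-refl _ a))

  loop∈ : ∀ a → proj₁ (loop a) ∈ M
  loop∈ a = proj₁ (proj₂ (loop a))

  loop-identity : ∀ a {x y} → ⟪ loop a ⟫ x y → x ≡ y
  loop-identity a e = proj₂ (diag-sound _
    (cell-⊆-union identity-union (loop∈ a) (proj₂ (proj₂ (loop a))) (diag-refl _ a) _ _ e))

  fiber : Fin n → Subset n
  fiber a x = proj₁ (loop a) x x

  fiber-refl : ∀ a → fiber a a ≡ true
  fiber-refl a = proj₂ (proj₂ (loop a))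

  fiber-isFiber : ∀ a → IsFiber M (fiber a)
  fiber-isFiber a = lose (loop∈ a) 1≐loop
    where
    1≐loop : diag (fiber a) ≐ proj₁ (loop a)
    1≐loop x y = true-ext into outof
      where
      into : diag (fiber a) x y ≡ true → proj₁ (loop a) x y ≡ true
      into e with diag-sound (fiber a) e
      ... | fax , refl = fax
      outof : proj₁ (loop a) x y ≡ true → diag (fiber a) x y ≡ true
      outof e with loop-identity a e
      ... | refl = trans (diag-refl (fiber a) x) e

  cell-endpoints : ∀ {r a b x y} → r ∈ M → r a b ≡ true → r x y ≡ true →
                   fiber a x ≡ true × fiber b y ≡ true
  cell-endpoints {r} {a} {b} {x} {y} r∈ rab rxy = source , target
    where
    source : fiber a x ≡ true
    source with path-transfer coherent (loop∈ a) r∈ r∈ rab rxy (a , fiber-refl a , rab)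
    ... | _ , e , _ = subst (λ w → proj₁ (loop a) x w ≡ true) (sym (loop-identity a e)) e
    target : fiber b y ≡ true
    target with path-transfer coherent r∈ (loop∈ b) r∈ rab rxy (b , rab , fiber-refl b)
    ... | _ , _ , e = subst (λ w → proj₁ (loop b) w y ≡ true) (loop-identity b e) e

  cell-inBlock : ∀ {r a b} → r ∈ M → r a b ≡ true → InBlock (fiber a) (fiber b) r
  cell-inBlock r∈ rab x y rxy = let fa , fb = cell-endpoints r∈ rab rxy in ∧-true⁺ fa fb

  cell-matching : ∀ {r a b} → r ∈ M → r a b ≡ true → IsMatching (fiber a) (fiber b) r
  cell-matching {r} {a} {b} r∈ rab
    with proj₂ matching (fiber a) (fiber b) (fiber-isFiber a) (fiber-isFiber b)
                        (lose r∈ (cell-inBlock r∈ rab))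
  ... | inj₁ (matchings , _) = All.lookup matchings r∈ (cell-inBlock r∈ rab)
  ... | inj₂ (same-fiber , diagonal) = diagonal-matching same-fiber
          (All.lookup diagonal r∈ λ x y rxy →
             let fa , fb = cell-endpoints r∈ rab rxy in ∧-true⁺ fa (trans (same-fiber y) fb))

  functional : ∀ {r x y y'} → r ∈ M → r x y ≡ true → r x y' ≡ true → y ≡ y'
  functional {x = x} r∈ rxy rxy' with proj₁ (proj₂ (cell-matching r∈ rxy)) x (fiber-refl x)
  ... | _ , _ , unique = trans (unique _ rxy) (sym (unique _ rxy'))

  injective : ∀ {r x x' y} → r ∈ M → r x y ≡ true → r x' y ≡ true → x ≡ x'
  injective {y = y} r∈ rxy rx'y with proj₂ (proj₂ (cell-matching r∈ rxy)) y (fiber-refl y)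
  ... | _ , _ , unique = trans (unique _ rxy) (sym (unique _ rx'y))

  total : ∀ {r a b x} → r ∈ M → r a b ≡ true → fiber a x ≡ true → ∃ λ y → r x y ≡ true
  total r∈ rab fax = let y , rxy , _ = proj₁ (proj₂ (cell-matching r∈ rab)) _ fax in y , rxy

  converse : ∀ {r} → r ∈ M → Σ (Rel n) λ r' → r' ∈ M × (∀ x y → r' x y ≡ r y x)
  converse r∈ = let r' , r'∈ , conv≐r' = find (All.lookup converse-closed r∈)
                in r' , r'∈ , λ x y → sym (conv≐r' x y)

  reverse : ∀ {x y} → CellAt x y → CellAt y x
  reverse (r , r∈ , rxy) = let r' , r'∈ , flips = converse r∈ in r' , r'∈ , trans (flips _ _) rxy

  reverse-⇔ : ∀ {x y} (ρ : CellAt x y) → ⟪ reverse ρ ⟫ ⇔ flip ⟪ ρ ⟫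
  reverse-⇔ (r , r∈ , _) = let _ , _ , flips = converse r∈
                           in (λ e → trans (sym (flips _ _)) e) , (λ e → trans (flips _ _) e)

  triangle : ∀ {α β γ} (ρ : CellAt α β) (σ : CellAt β γ) (δ : CellAt α γ) →
             ⟪ δ ⟫ ⇔ ⟪ ρ ⟫ ⨾ ⟪ σ ⟫
  triangle (r , r∈ , rαβ) (s , s∈ , sβγ) (d , d∈ , dαγ) = into , outof
    where
    into : ⟦ d ⟧ ⇒ ⟦ r ⟧ ⨾ ⟦ s ⟧
    into dxz = path-transfer coherent r∈ s∈ d∈ dαγ dxz (_ , rαβ , sβγ)
    -- r·s is a partial function, and d picks a value wherever r·s is defined
    outof : ⟦ r ⟧ ⨾ ⟦ s ⟧ ⇒ ⟦ d ⟧
    outof (y , rxy , syz) with total d∈ dαγ (proj₁ (cell-endpoints r∈ rαβ rxy))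
    ... | z' , dxz' with into dxz'
    ... | y' , rxy' , sy'z' with functional r∈ rxy rxy'
    ... | refl with functional s∈ syz sy'z'
    ... | refl = dxz'

  -- A cell κ leaving the fiber of β, followed by its reverse, is the identity
  -- there; so it may be inserted after any cell ρ ending at β.
  detour : ∀ {α β c} (ρ : CellAt α β) (κ : CellAt β c) (S : PRel n) →
           ⟪ ρ ⟫ ⨾ S ⇔ (⟪ ρ ⟫ ⨾ ⟪ κ ⟫) ⨾ (⟪ reverse κ ⟫ ⨾ S)
  detour (r , r∈ , rαβ) κ@(q , q∈ , qβc) S = forth , back
    where
    forth : ⟦ r ⟧ ⨾ S ⇒ (⟦ r ⟧ ⨾ ⟦ q ⟧) ⨾ (⟪ reverse κ ⟫ ⨾ S)
    forth (y , rxy , Syz) with total q∈ qβc (proj₂ (cell-endpoints r∈ rαβ rxy))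
    ... | w , qyw = w , (y , rxy , qyw) , (y , proj₂ (reverse-⇔ κ) qyw , Syz)
    back : (⟦ r ⟧ ⨾ ⟦ q ⟧) ⨾ (⟪ reverse κ ⟫ ⨾ S) ⇒ ⟦ r ⟧ ⨾ S
    back (w , (y , rxy , qyw) , (y' , q'wy' , Sy'z))
      with injective q∈ qyw (proj₁ (reverse-⇔ κ) q'wy')
    ... | refl = y , rxy , Sy'z

  rotate : ∀ {α β γ c} (ρ : CellAt α β) (σ : CellAt β γ) → CellAt β c →
           (κ : CellAt α c) (μ : CellAt c γ) → ⟪ ρ ⟫ ⨾ ⟪ σ ⟫ ⇔ ⟪ κ ⟫ ⨾ ⟪ μ ⟫
  rotate ρ σ q κ μ = begin
    ⟪ ρ ⟫ ⨾ ⟪ σ ⟫                                  ≈⟨ detour ρ q ⟪ σ ⟫ ⟩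
    (⟪ ρ ⟫ ⨾ ⟪ q ⟫) ⨾ (⟪ reverse q ⟫ ⨾ ⟪ σ ⟫)       ≈⟨ ⨾-cong (triangle ρ q κ) (triangle (reverse q) σ μ) ⟨
    ⟪ κ ⟫ ⨾ ⟪ μ ⟫                                  ∎
    where open SetoidReasoning (⇔-setoid n)

  reroute₃ : ∀ {α β γ δ c} (ρ : CellAt α β) (σ : CellAt β γ) (υ : CellAt γ δ) →
             CellAt β c → CellAt γ c → (κ : CellAt α c) (μ : CellAt c δ) →
             ⟪ ρ ⟫ ⨾ (⟪ σ ⟫ ⨾ ⟪ υ ⟫) ⇔ ⟪ κ ⟫ ⨾ ⟪ μ ⟫
  reroute₃ ρ σ υ βc γc κ μ = begin
    ⟪ ρ ⟫ ⨾ (⟪ σ ⟫ ⨾ ⟪ υ ⟫)    ≈⟨ ⨾-cong ⇔-refl (rotate σ υ γc βc μ) ⟩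
    ⟪ ρ ⟫ ⨾ (⟪ βc ⟫ ⨾ ⟪ μ ⟫)   ≈⟨ ⨾-assoc ⟨
    (⟪ ρ ⟫ ⨾ ⟪ βc ⟫) ⨾ ⟪ μ ⟫   ≈⟨ ⨾-cong (triangle ρ βc κ) ⇔-refl ⟨
    ⟪ κ ⟫ ⨾ ⟪ μ ⟫              ∎
    where open SetoidReasoning (⇔-setoid n)

  IsProduct : PRel n → Set
  IsProduct P = Σ (Rel n) λ r → Σ (Rel n) λ s → r ∈ M × s ∈ M × P ⇔ ⟦ r ⟧ ⨾ ⟦ s ⟧

  cells-product : ∀ {α c γ} {P : PRel n} (κ : CellAt α c) (μ : CellAt c γ) →
                  P ⇔ ⟪ κ ⟫ ⨾ ⟪ μ ⟫ → IsProduct P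
  cells-product (r , r∈ , _) (s , s∈ , _) P⇔ = r , s , r∈ , s∈ , P⇔

  product-functional : ∀ {P} → IsProduct P → ∀ {x y y'} → P x y → P x y' → y ≡ y'
  product-functional (r , s , r∈ , s∈ , P⇔) Pxy Pxy'
    with proj₁ P⇔ Pxy | proj₁ P⇔ Pxy'
  ... | m , rxm , smy | m' , rxm' , sm'y' with functional r∈ rxm rxm'
  ... | refl = functional s∈ smy sm'y'

  converse-product : ∀ {P} → IsProduct P → IsProduct (flip P)
  converse-product (r , s , r∈ , s∈ , P⇔) =
    let r' , r'∈ , r'-flips = converse r∈ ; s' , s'∈ , s'-flips = converse s∈ in
    s' , r' , s'∈ , r'∈ ,
    (λ Pzx → let y , rzy , syx = proj₁ P⇔ Pzx
             in y , trans (s'-flips _ _) syx , trans (r'-flips _ _) rzy) ,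
    (λ (y , s'xy , r'yz) → proj₂ P⇔ (y , trans (sym (r'-flips _ _)) r'yz , trans (sym (s'-flips _ _)) s'xy))

  -- A cell is a product (of itself with a loop).
  cell-product : ∀ {r a b} → r ∈ M → r a b ≡ true → IsProduct ⟦ r ⟧
  cell-product {b = b} r∈ rab = cells-product ρ (loop b) (triangle ρ (loop b) ρ)
    where ρ = _ , r∈ , rab

  loop²-identity : ∀ a {x y} → (⟪ loop a ⟫ ⨾ ⟪ loop a ⟫) x y → x ≡ y
  loop²-identity a (m , e , e') = trans (loop-identity a e) (loop-identity a e')

-- Saturated matching configurations.

module Saturated {n : ℕ} {M : List (Rel n)} (matching : IsMatchingConfiguration M)
                 (saturated : IsSaturated M) where

  open MatchingConfiguration matching

  common-neighbour : ∀ α β γ δ →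
    Σ (Fin n) λ c → CellAt c α × CellAt c β × CellAt c γ × CellAt c δ
  common-neighbour α β γ δ
    with saturated (fiber α ∷ fiber β ∷ fiber γ ∷ fiber δ ∷ [])
                   (fiber-isFiber α ∷ fiber-isFiber β ∷ fiber-isFiber γ ∷ fiber-isFiber δ ∷ [])
                   (s≤s (s≤s (s≤s (s≤s z≤n))))
  ... | Λ , Λ-fiber , (Λα ∷ Λβ ∷ Λγ ∷ Λδ ∷ []) =
    c , link Λα α (fiber-refl α) , link Λβ β (fiber-refl β)
      , link Λγ γ (fiber-refl γ) , link Λδ δ (fiber-refl δ)
    where
    c : Fin n
    c = proj₁ (fiber-inhabited partition Λ-fiber)
    link : ∀ {Λ'} → Sim M Λ Λ' → ∀ x → Λ' x ≡ true → CellAt c x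
    link (_ , covered) x Λ'x =
      let r , r∈ , _ , rcx = find (covered c x (∧-true⁺ (proj₂ (fiber-inhabited partition Λ-fiber)) Λ'x))
      in r , r∈ , rcx

  two-step-path : ∀ a b → Σ (Fin n) λ c → CellAt a c × CellAt c b
  two-step-path a b = let c , ca , cb , _ = common-neighbour a b a b in c , reverse ca , cb

  products-coincide : ∀ {P Q α γ} → IsProduct P → IsProduct Q → P α γ → Q α γ → P ⇔ Q
  products-coincide {P} {Q} {α} {γ} (r , s , r∈ , s∈ , P⇔) (r' , s' , r'∈ , s'∈ , Q⇔) Pαγ Qαγ
    with proj₁ P⇔ Pαγ | proj₁ Q⇔ Qαγ
  ... | β , rαβ , sβγ | β' , r'αβ' , s'β'γ with common-neighbour α β β' γ
  ... | c , cα , cβ , cβ' , cγ = begin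
    P                ≈⟨ P⇔ ⟩
    ⟦ r ⟧ ⨾ ⟦ s ⟧     ≈⟨ rotate (r , r∈ , rαβ) (s , s∈ , sβγ) (reverse cβ) (reverse cα) cγ ⟩
    ⟪ reverse cα ⟫ ⨾ ⟪ cγ ⟫ ≈⟨ rotate (r' , r'∈ , r'αβ') (s' , s'∈ , s'β'γ) (reverse cβ') (reverse cα) cγ ⟨
    ⟦ r' ⟧ ⨾ ⟦ s' ⟧   ≈⟨ Q⇔ ⟨
    Q                ∎
    where open SetoidReasoning (⇔-setoid n)

  reroute₄ : ∀ {α β γ δ ε c₁ c₂} (ρ₁ : CellAt α β) (σ₁ : CellAt β γ)
             (ρ₂ : CellAt γ δ) (σ₂ : CellAt δ ε) →
             (κ₁ : CellAt α c₁) → CellAt β c₁ → CellAt γ c₁ → (μ₁ : CellAt c₁ δ) →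
             (κ₂ : CellAt α c₂) → CellAt c₁ c₂ → CellAt δ c₂ → (μ₂ : CellAt c₂ ε) →
             (⟪ ρ₁ ⟫ ⨾ ⟪ σ₁ ⟫) ⨾ (⟪ ρ₂ ⟫ ⨾ ⟪ σ₂ ⟫) ⇔ ⟪ κ₂ ⟫ ⨾ ⟪ μ₂ ⟫
  reroute₄ ρ₁ σ₁ ρ₂ σ₂ κ₁ βc₁ γc₁ μ₁ κ₂ c₁c₂ δc₂ μ₂ = begin
    (⟪ ρ₁ ⟫ ⨾ ⟪ σ₁ ⟫) ⨾ (⟪ ρ₂ ⟫ ⨾ ⟪ σ₂ ⟫)  ≈⟨ ⨾-assoc₄ ⟩
    (⟪ ρ₁ ⟫ ⨾ (⟪ σ₁ ⟫ ⨾ ⟪ ρ₂ ⟫)) ⨾ ⟪ σ₂ ⟫  ≈⟨ ⨾-cong (reroute₃ ρ₁ σ₁ ρ₂ βc₁ γc₁ κ₁ μ₁) ⇔-refl ⟩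
    (⟪ κ₁ ⟫ ⨾ ⟪ μ₁ ⟫) ⨾ ⟪ σ₂ ⟫            ≈⟨ ⨾-assoc ⟩
    ⟪ κ₁ ⟫ ⨾ (⟪ μ₁ ⟫ ⨾ ⟪ σ₂ ⟫)            ≈⟨ reroute₃ κ₁ μ₁ σ₂ c₁c₂ δc₂ κ₂ μ₂ ⟩
    ⟪ κ₂ ⟫ ⨾ ⟪ μ₂ ⟫                      ∎
    where open SetoidReasoning (⇔-setoid n)

  path₄-product : ∀ {α β γ δ ε} (ρ₁ : CellAt α β) (σ₁ : CellAt β γ)
                  (ρ₂ : CellAt γ δ) (σ₂ : CellAt δ ε) →
                  IsProduct ((⟪ ρ₁ ⟫ ⨾ ⟪ σ₁ ⟫) ⨾ (⟪ ρ₂ ⟫ ⨾ ⟪ σ₂ ⟫))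
  path₄-product {α} {β} {γ} {δ} {ε} ρ₁ σ₁ ρ₂ σ₂ =
    let c₁ , c₁α , c₁β , c₁γ , c₁δ = common-neighbour α β γ δ
        c₂ , c₂α , c₂c₁ , c₂δ , c₂ε = common-neighbour α c₁ δ ε
    in cells-product (reverse c₂α) c₂ε
         (reroute₄ ρ₁ σ₁ ρ₂ σ₂ (reverse c₁α) (reverse c₁β) (reverse c₁γ) c₁δ
                               (reverse c₂α) (reverse c₂c₁) (reverse c₂δ) c₂ε)

  composite-product : ∀ {P Q α β} → IsProduct P → IsProduct Q → (P ⨾ Q) α β → IsProduct (P ⨾ Q)
  composite-product (r₁ , s₁ , r₁∈ , s₁∈ , P⇔) (r₂ , s₂ , r₂∈ , s₂∈ , Q⇔) (m , Pαm , Qmβ) =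
    let y , r₁αy , s₁ym = proj₁ P⇔ Pαm
        w , r₂mw , s₂wβ = proj₁ Q⇔ Qmβ
        r , s , r∈ , s∈ , composite⇔ =
          path₄-product (r₁ , r₁∈ , r₁αy) (s₁ , s₁∈ , s₁ym) (r₂ , r₂∈ , r₂mw) (s₂ , s₂∈ , s₂wβ)
    in r , s , r∈ , s∈ , ⇔-trans (⨾-cong P⇔ Q⇔) composite⇔

  nonEmpty? : (r : Rel n) → Dec (NonEmpty r)
  nonEmpty? r = Fin.any? λ a → Fin.any? λ b → r a b ≟ᵇ true

  ≐-decSetoid : DecSetoid 0ℓ 0ℓ
  ≐-decSetoid = record
    { Carrier = Rel n
    ; _≈_ = _≐_
    ; isDecEquivalence = record
      { isEquivalence = record
        { refl  = λ _ _ → refl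
        ; sym   = λ r≐s a b → sym (r≐s a b)
        ; trans = λ r≐s s≐t a b → trans (r≐s a b) (s≐t a b)
        }
      ; _≟_ = λ r s → Fin.all? λ a → Fin.all? λ b → r a b ≟ᵇ s a b
      }
    }

  open DecSetoid ≐-decSetoid using () renaming (_≟_ to _≐?_)

  nonempty-products : List (Rel n)
  nonempty-products = filter nonEmpty? (cartesianProductWith comp M M)

  products : List (Rel n)
  products = deduplicate _≐?_ nonempty-products

  products-sound : ∀ {t} → t ∈ products → NonEmpty t × IsProduct ⟦ t ⟧
  products-sound t∈ with ∈-filter⁻ nonEmpty? (Anyₚ.deduplicate⁻ _≐?_ t∈)
  ... | t∈pairs , nonempty with ∈-cartesianProductWith⁻ comp M M t∈pairs
  ... | r , s , r∈ , s∈ , refl = nonempty , r , s , r∈ , s∈ , comp⇔ r s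

  products-complete : ∀ {r s} → r ∈ M → s ∈ M → NonEmpty (comp r s) → comp r s ∈ₑ products
  products-complete r∈ s∈ nonempty =
    Anyₚ.deduplicate⁺ _≐?_ (λ t≐u rs≐u a b → trans (rs≐u a b) (sym (t≐u a b)))
      (lose (∈-filter⁺ nonEmpty? (∈-cartesianProductWith⁺ comp r∈ s∈) nonempty) (λ _ _ → refl))

  product-covers : ∀ {r s a b} → r ∈ M → s ∈ M → (⟦ r ⟧ ⨾ ⟦ s ⟧) a b →
                   Any (λ u → u a b ≡ true) products
  product-covers {r} {s} {a} {b} r∈ s∈ rsab =
    Any.map (λ rs≐u → trans (sym (rs≐u a b)) rsab')
            (products-complete r∈ s∈ (a , b , rsab'))
    where
    rsab' : comp r s a b ≡ true
    rsab' = proj₂ (comp⇔ r s) rsab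

  products-cover : ∀ a b → Any (λ u → u a b ≡ true) products
  products-cover a b = let _ , (r , r∈ , rac) , (s , s∈ , scb) = two-step-path a b
                       in product-covers r∈ s∈ (_ , rac , scb)

  -- Distinct entries are different relations and two entries that meet
  -- coincide, so the list is a partial partition.
  products-meet : ∀ {t u a b} → t ∈ products → u ∈ products → t a b ≡ true → u a b ≡ true → t ≐ u
  products-meet t∈ u∈ tab uab =
    ⇔⇒≐ (products-coincide (proj₂ (products-sound t∈)) (proj₂ (products-sound u∈)) tab uab)

  products-partition : IsPartialPartition products
  products-partition = All.tabulate (proj₁ ∘ products-sound) , disjoint
    where
    disjoint : ∀ i j → i ≢ j → Disjoint (lookup products i) (lookup products j)
    disjoint i j i≢j a b ei ej =
      lookup-distinct (λ r≉s s≐r → r≉s λ a b → sym (s≐r a b)) (deduplicate-! ≐-decSetoid nonempty-products) i j i≢j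
        (products-meet (∈-lookup i) (∈-lookup j) ei ej)

  -- A product through a point of the diagonal is the square of a loop, hence
  -- lies inside the identity.
  products-identity : IsUnionOf identity products
  products-identity = (λ a b _ → products-cover a b)
                    , All.tabulate λ t∈ → contained-or-disjoint λ taa' idaa' →
                        inside t∈ taa' (proj₂ (diag-sound _ idaa'))
    where
    inside : ∀ {t a a'} → t ∈ products → t a a' ≡ true → a ≡ a' → t ⊆ identity
    inside {a = a} t∈ taa refl x y txy =
      subst (λ z → identity x z ≡ true)
        (loop²-identity a (proj₁ (products-coincide (proj₂ (products-sound t∈))
                                     (cells-product (loop a) (loop a) ⇔-refl)
                                     taa (a , fiber-refl a , fiber-refl a)) txy))
        (diag-refl _ x)

  -- The converse of r·s is s*·r*.
  products-converse : All (λ t → conv t ∈ₑ products) products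
  products-converse = All.tabulate λ t∈ →
    let (a , b , tab) , t-product = products-sound t∈
        s' , r' , s'∈ , r'∈ , conv⇔ = converse-product t-product
        conv≐s'r' = ⇔⇒≐ (⇔-trans conv⇔ (⇔-sym (comp⇔ s' r')))
    in Any.map (λ s'r'≐u x y → trans (conv≐s'r' x y) (s'r'≐u x y))
               (products-complete s'∈ r'∈ (b , a , trans (sym (conv≐s'r' b a)) tab))

  composite-transfer : ∀ {t₁ t₂ t α β α' β'} → t₁ ∈ products → t₂ ∈ products → t ∈ products →
    t α β ≡ true → t α' β' ≡ true → comp t₁ t₂ α β ≡ true → comp t₁ t₂ α' β' ≡ true
  composite-transfer {t₁} {t₂} t₁∈ t₂∈ t∈ tαβ tα'β' t₁t₂αβ =
    proj₂ (comp⇔ t₁ t₂) (proj₁ (products-coincide (proj₂ (products-sound t∈))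
      (composite-product (proj₂ (products-sound t₁∈)) (proj₂ (products-sound t₂∈)) t₁t₂αβ')
      tαβ t₁t₂αβ') tα'β')
    where t₁t₂αβ' = proj₁ (comp⇔ t₁ t₂) t₁t₂αβ

  -- Intersection numbers are indicators of composites, hence constant on cells.
  products-coherent : ∀ {t₁ t₂ t} → t₁ ∈ products → t₂ ∈ products → t ∈ products →
    ∀ α β α' β' → t α β ≡ true → t α' β' ≡ true →
    interNum t₁ t₂ α β ≡ interNum t₁ t₂ α' β'
  products-coherent {t₁} {t₂} t₁∈ t₂∈ t∈ α β α' β' tαβ tα'β' = begin
    interNum t₁ t₂ α β                   ≡⟨ interNum-indicator t₁ t₂ α β t₁-functional ⟩
    (if comp t₁ t₂ α β then 1 else 0)    ≡⟨ cong (λ v → if v then 1 else 0)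
                                              (true-ext (composite-transfer t₁∈ t₂∈ t∈ tαβ tα'β')
                                                        (composite-transfer t₁∈ t₂∈ t∈ tα'β' tαβ)) ⟩
    (if comp t₁ t₂ α' β' then 1 else 0)  ≡⟨ interNum-indicator t₁ t₂ α' β' t₁-functional ⟨
    interNum t₁ t₂ α' β'                 ∎
    where
    open ≡-Reasoning
    t₁-functional : ∀ {x y y'} → t₁ x y ≡ true → t₁ x y' ≡ true → y ≡ y'
    t₁-functional = product-functional (proj₂ (products-sound t₁∈))

  products-coherentConfiguration : IsCoherentConfiguration products
  products-coherentConfiguration =
    (products-partition , products-identity , products-converse , products-coherent) , products-cover

  M≤products : M ≤ᶜ products
  M≤products = All.tabulate λ r∈ →
      (λ a b rab → product-covers r∈ (loop∈ b) (b , rab , fiber-refl b))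
    , All.tabulate λ u∈ → contained-or-disjoint λ uab rab x y →
        proj₁ (products-coincide (proj₂ (products-sound u∈)) (cell-product r∈ rab) uab rab)

  -- The coherent closure.

  module Closure (T : List (Rel n)) (closure : IsCoherentClosure M T) where

    T-coherent : IsCoherentConfiguration T
    T-coherent = proj₁ closure

    T-nonempty : All NonEmpty T
    T-nonempty = proj₁ (proj₁ (proj₁ T-coherent))

    M≤T : M ≤ᶜ T
    M≤T = proj₁ (proj₂ closure)

    T≤products : T ≤ᶜ products
    T≤products = proj₂ (proj₂ closure) products products-coherentConfiguration M≤products

    -- Coherence of T: a cell of T lies inside every product of cells of M it meets.
    cell⊆product : ∀ {t r s a b} → t ∈ T → t a b ≡ true → r ∈ M → s ∈ M →
                   (⟦ r ⟧ ⨾ ⟦ s ⟧) a b → ⟦ t ⟧ ⇒ ⟦ r ⟧ ⨾ ⟦ s ⟧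
    cell⊆product t∈ tab r∈ s∈ (β , raβ , sβb) ta'b'
      with covering-cell (All.lookup M≤T r∈) raβ | covering-cell (All.lookup M≤T s∈) sβb
    ... | u₁ , u₁∈ , u₁aβ , u₁⊆r | u₂ , u₂∈ , u₂βb , u₂⊆s
      with path-transfer (proj₁ T-coherent) u₁∈ u₂∈ t∈ tab ta'b' (β , u₁aβ , u₂βb)
    ... | γ , u₁a'γ , u₂γb' = γ , u₁⊆r _ _ u₁a'γ , u₂⊆s _ _ u₂γb'

    -- Since T ≤ (M·M)^#, a cell of T contains every product it meets.
    product⊆cell : ∀ {t P a b} → t ∈ T → t a b ≡ true → IsProduct P → P a b → P ⇒ ⟦ t ⟧
    product⊆cell t∈ tab P-product Pab Pxy =
      let u , u∈ , uab , u⊆t = covering-cell (All.lookup T≤products t∈) tab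
      in u⊆t _ _ (proj₁ (products-coincide P-product (proj₂ (products-sound u∈)) Pab uab) Pxy)

    cell-is-product : ∀ {t r s a b} → t ∈ T → t a b ≡ true → r ∈ M → s ∈ M →
                      comp r s a b ≡ true → t ≐ comp r s
    cell-is-product {r = r} {s} t∈ tab r∈ s∈ rsab = ⇔⇒≐
      ( proj₂ (comp⇔ r s) ∘ cell⊆product t∈ tab r∈ s∈ rsab'
      , product⊆cell t∈ tab (r , s , r∈ , s∈ , comp⇔ r s) rsab)
      where rsab' = proj₁ (comp⇔ r s) rsab

    cells-are-products : All (λ t → NonEmpty t × Σ (Rel n) λ r → Σ (Rel n) λ s →
                                      r ∈ M × s ∈ M × t ≐ comp r s) T
    cells-are-products = All.tabulate λ t∈ →
      let a , b , tab = All.lookup T-nonempty t∈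
          _ , (r , r∈ , rac) , (s , s∈ , scb) = two-step-path a b
      in (a , b , tab) , r , s , r∈ , s∈ ,
         cell-is-product t∈ tab r∈ s∈ (proj₂ (comp⇔ r s) (_ , rac , scb))

    products-are-cells : ∀ {r s} → r ∈ M → s ∈ M → NonEmpty (comp r s) → comp r s ∈ₑ T
    products-are-cells r∈ s∈ (a , b , rsab) =
      let t , t∈ , tab = find (proj₂ T-coherent a b)
      in lose t∈ λ x y → sym (cell-is-product t∈ tab r∈ s∈ rsab x y)

theorem4p2 : (n : ℕ) (M T : List (Rel n)) →
    IsMatchingConfiguration M → IsSaturated M →
    IsCoherentClosure M T →
    EqualsNonemptyProducts M T
theorem4p2 n M T matching saturated closure = cells-are-products , products-are-cells
  where open Saturated.Closure matching saturated T closure
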